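{- Let $G$ be an $r$-uniform multi-hypergraph on vertex set $V$ with $m$ edges, let $c>0$ be a constant, and let $V_1,V_2,\ldots,V_r$ be a partition of $V$ for which $\sum_{i=1}^r d(V_i)$ is as large as possible among all partitions of $V$ into $r$ parts, ordered such that $d(V_1)\ge d(V_2)\ge\cdots\ge d(V_r)$. If $d(V_{r-1})\ge cm$, then either (i) there exists a partition $W_1,\ldots,W_r$ of $V$ with $W_i\subseteq V_i$ for $1\le i\le r-1$ (so $W_r\supseteq V_r$) such that $d(W_i)\ge cm$ for every $i$; or (ii) there exists a partition $W_1,\ldots,W_r$ of $V$ with $W_i\subseteq V_i$ for $1\le i\le r-1$ such that for each $i\ne r$ we have $d(W_i)\ge cm$ but $d(W_i\setminus\{w\})<cm$ for every $w\in W_i$, and moreover $$\sum_{i=1}^{r-1} d(W_i)>(r+1)(m-cm).$$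
   Context: An $r$-uniform multi-hypergraph on a finite vertex set $V$ is a finite multiset of $r$-element subsets of $V$ (edges), repeated edges allowed and counted with multiplicity; $r\ge 2$ is an integer. For $X\subseteq V$, $d(X)$ denotes the number of edges meeting $X$ (having nonempty intersection with $X$), counted with multiplicity.
   Formalization: The constant c ranges over the positive rationals. -}

module Defs where

open import Data.Nat using (ℕ; suc)
open import Data.Fin using (Fin; _≟_)
open import Data.Fin.Subset using (Subset; ∣_∣; _∩_; Nonempty)
open import Data.Fin.Subset.Properties using (nonempty?)
open import Data.List using (List; length; filter; map; allFin)
open import Data.Nat.ListAction using (sum)
open import Data.List.Relation.Unary.All using (All)
open import Data.Vec using (tabulate)
open import Data.Integer using (+_)
open import Data.Rational using (ℚ; _/_)
open import Relation.Binary.PropositionalEquality using (_≡_)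
open import Relation.Nullary.Decidable using (⌊_⌋)

-- An r-uniform multi-hypergraph on the vertex set Fin n: a finite list
-- (multiset) of edges, each an r-element subset of Fin n.
record MultiHypergraph (n r : ℕ) : Set where
  field
    edges   : List (Subset n)
    uniform : All (λ e → ∣ e ∣ ≡ r) edges
open MultiHypergraph public

#edges : ∀ {n r} → MultiHypergraph n r → ℕ
#edges G = length (edges G)

deg : ∀ {n r} → MultiHypergraph n r → Subset n → ℕ
deg G X = length (filter (λ e → nonempty? (e ∩ X)) (edges G))

-- A partition of Fin n into k (labelled, possibly empty) parts is given by
-- an assignment of a part index to every vertex; part p i is the i-th part.
Partition : ℕ → ℕ → Set
Partition n k = Fin n → Fin k

part : ∀ {n k} → Partition n k → Fin k → Subset n
part p i = tabulate (λ v → ⌊ p v ≟ i ⌋)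

totalDeg : ∀ {n r k} → MultiHypergraph n r → Partition n k → ℕ
totalDeg {k = k} G p = sum (map (λ i → deg G (part p i)) (allFin k))

toℚ : ℕ → ℚ
toℚ m = + m / 1

module Submission where

-- Greedily move vertices of the inner parts V₁, …, V_{r-1} into the last part V_r as long as the
-- part they leave keeps degree at least cm.  The resulting W has heavy inner parts from which no
-- vertex can be removed, which is (i) if also d(W_r) ≥ cm.  Otherwise let A be the set of edges
-- missing W_r, so that |A| = m − d(W_r) > m − cm.  By optimality of V, moving one inner vertex u
-- of W into the last part does not increase Σ d(V_i): the move gains the edges through u that miss
-- V_r and loses those in which u is the only vertex of its V-part, hence of its W-part.  Summed
-- over the inner vertices, each edge of A gains r, as all its r vertices are inner, while each
-- edge e loses at most the number J(e) of inner W-parts it meets, and strictly fewer if e ∈ A,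
-- because r vertices in r − 1 parts cannot all be alone.  So r|A| ≤ Σ_e J(e) − |A|, that is
-- (r + 1)|A| ≤ Σ_{i<r} d(W_i), which gives (ii).

open import Defs
open import Data.Bool using (Bool; true; false; _∧_; _∨_; not; T)
open import Data.Bool.ListAction using (any; or)
open import Data.Bool.Properties using (∧-zeroʳ; ∧-identityʳ; T-≡; T-∧; T-∨)
open import Data.Empty using (⊥-elim)
open import Data.Fin using (Fin; zero; suc; fromℕ; inject₁; _≟_)
open import Data.Fin.Relation.Unary.Top using (view; ‵fromℕ; ‵inj₁)
import Data.Fin.Properties as Fin
open import Data.Fin.Subset using (Subset; _∩_; _⊆_; _∈_; _-_; ∣_∣; Nonempty)
open import Data.Fin.Subset.Properties using (nonempty?; x∈p∩q⁺; x∈p∩q⁻; p─⊥≡p)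
open import Data.List using (List; []; _∷_; map; allFin; length; filter)
open import Data.List.Membership.Propositional using (lose)
open import Data.List.Membership.Propositional.Properties using (∈-allFin)
import Data.List.Properties as List
open import Data.List.Relation.Unary.All using (All; []; _∷_)
import Data.List.Relation.Unary.All.Properties as All
open import Data.List.Relation.Unary.Any using (satisfied)
open import Data.List.Relation.Unary.Any.Properties using (any⁺; any⁻)
open import Data.Nat using (ℕ; zero; suc; _+_; _≤_; _<_; z≤n; s≤s)
import Data.Nat as ℕ
open import Data.Nat.ListAction using (sum)
open import Data.Nat.Properties hiding (_≟_)
open import Algebra.Properties.CommutativeSemigroup +-commutativeSemigroup using (interchange)
open import Data.Product using (Σ; ∃; _×_; _,_; proj₁; proj₂)
open import Data.Sum using (_⊎_; inj₁; inj₂)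
open import Data.Vec using (lookup; []; _∷_)
open import Data.Vec.Functional using (updateAt)
open import Data.Vec.Functional.Properties using (updateAt-updates; updateAt-minimal)
import Data.Vec.Properties as Vec
open import Data.Rational using (ℚ; 0ℚ; _*_; mkℚ; _/_)
import Data.Rational as ℚ
import Data.Rational.Properties as ℚ
import Data.Integer as ℤ
import Data.Integer.Properties as ℤ
open import Data.Nat.Coprimality using (1-coprimeTo)
import Data.Nat.Coprimality as Coprime
open import Function using (_∘_; id; const; flip; Equivalence; case_of_)
open import Relation.Binary.PropositionalEquality
open import Relation.Nullary using (¬_; Dec; yes; no; does)
open import Relation.Nullary.Decidable using (⌊_⌋; toWitness; fromWitness; isYes≗does; dec-true; dec-false)

variable
  A B : Set
  n : ℕ

𝟙 : Bool → ℕ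
𝟙 true  = 1
𝟙 false = 0

variable
  a b : Bool

T-ext : (T a → T b) → (T b → T a) → a ≡ b
T-ext {false} {false} _ _ = refl
T-ext {false} {true}  _ f = ⊥-elim (f _)
T-ext {true}  {false} f _ = ⊥-elim (f _)
T-ext {true}  {true}  _ _ = refl

𝟙-mono : (T a → T b) → 𝟙 a ≤ 𝟙 b
𝟙-mono {false}            _ = z≤n
𝟙-mono {true}  {b = true}  _ = ≤-refl
𝟙-mono {true}  {b = false} f = ⊥-elim (f _)

𝟙-∨ : ∀ a b → 𝟙 (a ∨ b) ≡ 𝟙 a + 𝟙 (b ∧ not a)
𝟙-∨ true  b = cong suc (cong 𝟙 (sym (∧-zeroʳ b)))
𝟙-∨ false b = cong 𝟙 (sym (∧-identityʳ b))

𝟙-false : ¬ T b → 𝟙 b ≡ 0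
𝟙-false {false} _  = refl
𝟙-false {true}  ¬t = ⊥-elim (¬t _)

𝟙-pos : T b → 0 < 𝟙 b
𝟙-pos {true} _ = s≤s z≤n

𝟙+𝟙-not : ∀ b → 𝟙 b + 𝟙 (not b) ≡ 1
𝟙+𝟙-not true  = refl
𝟙+𝟙-not false = refl

T-∧⁺ : T a → T b → T (a ∧ b)
T-∧⁺ ta tb = Equivalence.from T-∧ (ta , tb)

T-∧⁻ : T (a ∧ b) → T a × T b
T-∧⁻ = Equivalence.to T-∧

T-not⁺ : ¬ T a → T (not a)
T-not⁺ {false} _  = _
T-not⁺ {true}  ¬t = ¬t _

T-not⁻ : T (not a) → ¬ T a
T-not⁻ {false} _ ()

does≡ : {P : Set} (P? : Dec P) → (P → T b) → (T b → P) → does P? ≡ b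
does≡ {b = false} (yes p) to _    = ⊥-elim (to p)
does≡ {b = true}  (yes p) _  _    = refl
does≡ {b = false} (no ¬p) _  _    = refl
does≡ {b = true}  (no ¬p) _  from = ⊥-elim (¬p (from _))

⌊⌋-true : {P : Set} (P? : Dec P) → P → ⌊ P? ⌋ ≡ true
⌊⌋-true P? p = trans (isYes≗does P?) (dec-true P? p)

⌊⌋-false : {P : Set} (P? : Dec P) → ¬ P → ⌊ P? ⌋ ≡ false
⌊⌋-false P? ¬p = trans (isYes≗does P?) (dec-false P? ¬p)

≟-suc : (x y : Fin n) → ⌊ suc x ≟ suc y ⌋ ≡ ⌊ x ≟ y ⌋
≟-suc x y with x ≟ y
... | yes _ = refl
... | no  _ = refl

∑ : List A → (A → ℕ) → ℕ
∑ xs f = sum (map f xs)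

∑-cong : (xs : List A) {f g : A → ℕ} → (∀ x → f x ≡ g x) → ∑ xs f ≡ ∑ xs g
∑-cong xs f≗g = cong sum (List.map-cong f≗g xs)

∑-mono : (xs : List A) {f g : A → ℕ} → (∀ x → f x ≤ g x) → ∑ xs f ≤ ∑ xs g
∑-mono []       f≤g = z≤n
∑-mono (x ∷ xs) f≤g = +-mono-≤ (f≤g x) (∑-mono xs f≤g)

∑-mono-All : {P : A → Set} {xs : List A} {f g : A → ℕ} →
             All P xs → (∀ {x} → P x → f x ≤ g x) → ∑ xs f ≤ ∑ xs g
∑-mono-All []         f≤g = z≤n
∑-mono-All (px ∷ pxs) f≤g = +-mono-≤ (f≤g px) (∑-mono-All pxs f≤g)

∑-+ : (xs : List A) (f g : A → ℕ) → ∑ xs (λ x → f x + g x) ≡ ∑ xs f + ∑ xs g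
∑-+ []       f g = refl
∑-+ (x ∷ xs) f g =
  trans (cong (f x + g x +_) (∑-+ xs f g)) (interchange (f x) (g x) (∑ xs f) (∑ xs g))

∑-*ˡ : (xs : List A) (k : ℕ) (f : A → ℕ) → ∑ xs (λ x → k ℕ.* f x) ≡ k ℕ.* ∑ xs f
∑-*ˡ []       k f = sym (*-zeroʳ k)
∑-*ˡ (x ∷ xs) k f = trans (cong (k ℕ.* f x +_) (∑-*ˡ xs k f)) (sym (*-distribˡ-+ k (f x) (∑ xs f)))

∑-zero : (xs : List A) {f : A → ℕ} → (∀ x → f x ≡ 0) → ∑ xs f ≡ 0
∑-zero []       f≗0 = refl
∑-zero (x ∷ xs) {f} f≗0 = trans (cong (_+ ∑ xs f) (f≗0 x)) (∑-zero xs f≗0)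

∑-const-1 : (xs : List A) → ∑ xs (λ _ → 1) ≡ length xs
∑-const-1 []       = refl
∑-const-1 (x ∷ xs) = cong suc (∑-const-1 xs)

∑-comm : (xs : List A) (ys : List B) (f : A → B → ℕ) →
         ∑ xs (λ x → ∑ ys (f x)) ≡ ∑ ys (λ y → ∑ xs (λ x → f x y))
∑-comm []       ys f = sym (∑-zero ys (λ _ → refl))
∑-comm (x ∷ xs) ys f =
  trans (cong (∑ ys (f x) +_) (∑-comm xs ys f)) (sym (∑-+ ys (f x) (λ y → ∑ xs (λ x → f x y))))

length-filter≡∑ : {P : A → Set} (P? : (x : A) → Dec (P x)) (xs : List A) →
                  length (filter P? xs) ≡ ∑ xs (λ x → 𝟙 (does (P? x)))
length-filter≡∑ P? []       = refl
length-filter≡∑ P? (x ∷ xs) with does (P? x)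
... | true  = cong suc (length-filter≡∑ P? xs)
... | false = length-filter≡∑ P? xs

∑-allFin-suc : (f : Fin (suc n) → ℕ) → ∑ (allFin (suc n)) f ≡ f zero + ∑ (allFin n) (f ∘ suc)
∑-allFin-suc f = cong (λ ys → f zero + sum ys)
  (trans (List.map-tabulate suc f) (sym (List.map-tabulate id (f ∘ suc))))

∑-allFin-inject₁ : (x : Fin (suc n)) →
                   ∑ (allFin n) (λ i → 𝟙 ⌊ x ≟ inject₁ i ⌋) ≡ 𝟙 (not ⌊ x ≟ fromℕ n ⌋)
∑-allFin-inject₁ {zero}  zero    = refl
∑-allFin-inject₁ {suc n} zero    =
  trans (∑-allFin-suc {n} (λ i → 𝟙 ⌊ zero ≟ inject₁ i ⌋))
        (cong suc (∑-zero (allFin n) (λ _ → refl)))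
∑-allFin-inject₁ {suc n} (suc x) =
  trans (∑-allFin-suc {n} (λ i → 𝟙 ⌊ suc x ≟ inject₁ i ⌋))
        (trans (∑-cong (allFin n) (λ i → cong 𝟙 (≟-suc x (inject₁ i))))
               (trans (∑-allFin-inject₁ x) (cong (𝟙 ∘ not) (sym (≟-suc x (fromℕ n))))))

∑-allFin-inject₁-∧ : (x : Fin (suc n)) (b : Bool) →
                     ∑ (allFin n) (λ i → 𝟙 (⌊ x ≟ inject₁ i ⌋ ∧ b)) ≡
                     𝟙 (not ⌊ x ≟ fromℕ n ⌋ ∧ b)
∑-allFin-inject₁-∧ {n} x true  =
  trans (∑-cong (allFin n) (λ i → cong 𝟙 (∧-identityʳ _)))
        (trans (∑-allFin-inject₁ x) (cong 𝟙 (sym (∧-identityʳ _))))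
∑-allFin-inject₁-∧ {n} x false =
  trans (∑-zero (allFin n) (λ i → cong 𝟙 (∧-zeroʳ _))) (cong 𝟙 (sym (∧-zeroʳ _)))

∑-allFin-δ : (i : Fin n) (a : ℕ) → ∑ (allFin n) (λ j → 𝟙 ⌊ j ≟ i ⌋ ℕ.* a) ≡ a
∑-allFin-δ {suc n} zero    a =
  trans (∑-allFin-suc {n} (λ j → 𝟙 ⌊ j ≟ zero ⌋ ℕ.* a))
        (trans (cong₂ _+_ (+-identityʳ a) (∑-zero (allFin n) (λ _ → refl))) (+-identityʳ a))
∑-allFin-δ {suc n} (suc i) a =
  trans (∑-allFin-suc {n} (λ j → 𝟙 ⌊ j ≟ suc i ⌋ ℕ.* a))
        (trans (∑-cong (allFin n) (λ j → cong (λ b → 𝟙 b ℕ.* a) (≟-suc j i))) (∑-allFin-δ i a))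

∑-allFin-exchange : (f g : Fin n → ℕ) {i l : Fin n} (a b : ℕ) → i ≢ l →
                    (∀ j → j ≢ i → j ≢ l → f j ≡ g j) → f i + a ≡ g i → f l ≡ g l + b →
                    ∑ (allFin n) f + a ≡ ∑ (allFin n) g + b
∑-allFin-exchange {n} f g {i} {l} a b i≢l f≡g fi+a≡gi fl≡gl+b = begin
  ∑ (allFin n) f + a                                       ≡⟨ cong (∑ (allFin n) f +_) (∑-allFin-δ i a) ⟨
  ∑ (allFin n) f + ∑ (allFin n) (λ j → 𝟙 ⌊ j ≟ i ⌋ ℕ.* a)  ≡⟨ ∑-+ (allFin n) f _ ⟨
  ∑ (allFin n) (λ j → f j + 𝟙 ⌊ j ≟ i ⌋ ℕ.* a)             ≡⟨ ∑-cong (allFin n) pointwise ⟩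
  ∑ (allFin n) (λ j → g j + 𝟙 ⌊ j ≟ l ⌋ ℕ.* b)             ≡⟨ ∑-+ (allFin n) g _ ⟩
  ∑ (allFin n) g + ∑ (allFin n) (λ j → 𝟙 ⌊ j ≟ l ⌋ ℕ.* b)  ≡⟨ cong (∑ (allFin n) g +_) (∑-allFin-δ l b) ⟩
  ∑ (allFin n) g + b                                       ∎
  where
  open ≡-Reasoning
  pointwise : ∀ j → f j + 𝟙 ⌊ j ≟ i ⌋ ℕ.* a ≡ g j + 𝟙 ⌊ j ≟ l ⌋ ℕ.* b
  pointwise j with j ≟ i | j ≟ l
  ... | yes refl | yes refl = ⊥-elim (i≢l refl)
  ... | yes refl | no  _    = trans (cong (f j +_) (+-identityʳ a)) (trans fi+a≡gi (sym (+-identityʳ (g j))))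
  ... | no  _    | yes refl = trans (+-identityʳ (f j)) (trans fl≡gl+b (cong (g j +_) (sym (+-identityʳ b))))
  ... | no j≢i   | no j≢l   = cong (_+ 0) (f≡g j j≢i j≢l)

∑-𝟙-≤1 : (f : Fin n → Bool) → (∀ u v → T (f u) → T (f v) → u ≡ v) →
         ∑ (allFin n) (𝟙 ∘ f) ≤ 1
∑-𝟙-≤1 {zero}  f unique = z≤n
∑-𝟙-≤1 {suc n} f unique rewrite ∑-allFin-suc (𝟙 ∘ f) with f zero in f0
... | true  = ≤-reflexive (cong suc (∑-zero (allFin n) (λ v → 𝟙-false (0≢suc ∘ unique zero (suc v) f-zero))))
  where
  f-zero : T (f zero)
  f-zero = subst T (sym f0) _
  0≢suc : ∀ {v : Fin n} → zero ≢ suc v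
  0≢suc ()
... | false = ∑-𝟙-≤1 (f ∘ suc) (λ u v fu fv → Fin.suc-injective (unique (suc u) (suc v) fu fv))

∑-𝟙-≤-𝟙 : (f : Fin n → Bool) → (∀ u → T (f u) → T b) →
           (∀ u v → T (f u) → T (f v) → u ≡ v) → ∑ (allFin n) (𝟙 ∘ f) ≤ 𝟙 b
∑-𝟙-≤-𝟙 {b = true}  f _     unique = ∑-𝟙-≤1 f unique
∑-𝟙-≤-𝟙 {b = false} f fu⇒b _      = ≤-reflexive (∑-zero (allFin _) (λ u → 𝟙-false (fu⇒b u)))

∑-𝟙-exists : (f : Fin n → Bool) → 0 < ∑ (allFin n) (𝟙 ∘ f) → ∃ λ u → T (f u)
∑-𝟙-exists {zero}  f ()
∑-𝟙-exists {suc n} f 0<∑ rewrite ∑-allFin-suc (𝟙 ∘ f) with f zero in f0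
... | true  = zero , subst T (sym f0) _
... | false with ∑-𝟙-exists (f ∘ suc) 0<∑
...   | u , fu = suc u , fu

∑-<-or-≥ : (a b : Fin n → ℕ) → (∀ i → a i ≤ b i) →
           ∑ (allFin n) a < ∑ (allFin n) b ⊎ (∀ i → b i ≤ a i)
∑-<-or-≥ {zero}  a b a≤b = inj₂ λ ()
∑-<-or-≥ {suc n} a b a≤b rewrite ∑-allFin-suc a | ∑-allFin-suc b with b zero ≤? a zero
... | no  b0≰a0 = inj₁ (+-mono-<-≤ (≰⇒> b0≰a0) (∑-mono (allFin n) (a≤b ∘ suc)))
... | yes b0≤a0 with ∑-<-or-≥ (a ∘ suc) (b ∘ suc) (a≤b ∘ suc)
...   | inj₁ <   = inj₁ (+-mono-≤-< (a≤b zero) <)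
...   | inj₂ b≤a = inj₂ λ { zero → b0≤a0 ; (suc i) → b≤a i }

∈⇒T : {p : Subset n} {v : Fin n} → v ∈ p → T (lookup p v)
∈⇒T v∈p = subst T (sym (Vec.[]=⇒lookup v∈p)) _

T⇒∈ : {p : Subset n} {v : Fin n} → T (lookup p v) → v ∈ p
T⇒∈ {p = p} {v} t = Vec.lookup⇒[]= v p (Equivalence.to T-≡ t)

lookup-- : (X : Subset n) (w v : Fin n) → lookup (X - w) v ≡ lookup X v ∧ not ⌊ v ≟ w ⌋
lookup-- (x ∷ X) zero    zero    = sym (∧-zeroʳ x)
lookup-- (x ∷ X) zero    (suc v) =
  trans (cong (λ Y → lookup Y v) (p─⊥≡p X)) (sym (∧-identityʳ (lookup X v)))
lookup-- (x ∷ X) (suc w) zero    = sym (∧-identityʳ x)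
lookup-- (x ∷ X) (suc w) (suc v) = trans (lookup-- X w v) (cong (λ b → lookup X v ∧ not b) (sym (≟-suc v w)))

∑-lookup≡∣∣ : (p : Subset n) → ∑ (allFin n) (𝟙 ∘ lookup p) ≡ ∣ p ∣
∑-lookup≡∣∣ []          = refl
∑-lookup≡∣∣ (true  ∷ p) =
  trans (∑-allFin-suc (𝟙 ∘ lookup (true ∷ p))) (cong suc (∑-lookup≡∣∣ p))
∑-lookup≡∣∣ (false ∷ p) = trans (∑-allFin-suc (𝟙 ∘ lookup (false ∷ p))) (∑-lookup≡∣∣ p)

-- Vertex sets are Boolean predicates here, so that blocks of partitions and vertex deletions
-- are computed pointwise.
meets : Subset n → (Fin n → Bool) → Bool
meets {n} e X = any (λ v → lookup e v ∧ X v) (allFin n)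

_∖_ : (Fin n → Bool) → Fin n → Fin n → Bool
(X ∖ u) v = X v ∧ not ⌊ v ≟ u ⌋

∖-absent : (X : Fin n → Bool) {u : Fin n} → X u ≡ false → ∀ v → (X ∖ u) v ≡ X v
∖-absent X {u} Xu≡false v with v ≟ u
... | yes refl = trans (∧-zeroʳ (X v)) (sym Xu≡false)
... | no  _    = ∧-identityʳ (X v)

module _ (e : Subset n) where

  meets⁺ : {X : Fin n → Bool} (v : Fin n) → T (lookup e v) → T (X v) → T (meets e X)
  meets⁺ v ev Xv = any⁺ _ (lose (∈-allFin v) (T-∧⁺ ev Xv))

  meets⁻ : {X : Fin n → Bool} → T (meets e X) → ∃ λ v → T (lookup e v) × T (X v)
  meets⁻ m with satisfied (any⁻ _ (allFin n) m)
  ... | v , ev∧Xv = v , T-∧⁻ ev∧Xv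

  meets-mono : {X Y : Fin n → Bool} → (∀ v → T (X v) → T (Y v)) → T (meets e X) → T (meets e Y)
  meets-mono X⊆Y m with meets⁻ m
  ... | v , ev , Xv = meets⁺ v ev (X⊆Y v Xv)

  meets-cong : {X Y : Fin n → Bool} → (∀ v → X v ≡ Y v) → meets e X ≡ meets e Y
  meets-cong X≗Y = cong or (List.map-cong (λ v → cong (lookup e v ∧_) (X≗Y v)) (allFin n))

  meets-∖ : (X : Fin n → Bool) (u : Fin n) → meets e X ≡ meets e (X ∖ u) ∨ (lookup e u ∧ X u)
  meets-∖ X u = T-ext split merge
    where
    split : T (meets e X) → T (meets e (X ∖ u) ∨ (lookup e u ∧ X u))
    split m with meets⁻ m
    ... | v , ev , Xv with v ≟ u
    ...   | yes refl = Equivalence.from T-∨ (inj₂ (T-∧⁺ ev Xv))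
    ...   | no  v≢u  =
      Equivalence.from T-∨ (inj₁ (meets⁺ v ev (T-∧⁺ Xv (T-not⁺ (v≢u ∘ toWitness)))))
    merge : T (meets e (X ∖ u) ∨ (lookup e u ∧ X u)) → T (meets e X)
    merge t with Equivalence.to T-∨ t
    ... | inj₁ m     = meets-mono (λ _ → proj₁ ∘ T-∧⁻) m
    ... | inj₂ eu∧Xu = meets⁺ u (proj₁ (T-∧⁻ eu∧Xu)) (proj₂ (T-∧⁻ eu∧Xu))

  𝟙-meets-∖ : (X : Fin n → Bool) {u : Fin n} → X u ≡ true →
              𝟙 (meets e X) ≡ 𝟙 (meets e (X ∖ u)) + 𝟙 (lookup e u ∧ not (meets e (X ∖ u)))
  𝟙-meets-∖ X {u} Xu≡true = begin
    𝟙 (meets e X)                                              ≡⟨ cong 𝟙 (meets-∖ X u) ⟩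
    𝟙 (m ∨ (lookup e u ∧ X u))                                 ≡⟨ 𝟙-∨ m _ ⟩
    𝟙 m + 𝟙 ((lookup e u ∧ X u) ∧ not m)                       ≡⟨ cong (λ b → 𝟙 m + 𝟙 (b ∧ not m)) eu∧Xu≡eu ⟩
    𝟙 m + 𝟙 (lookup e u ∧ not m)                               ∎
    where
    open ≡-Reasoning
    m = meets e (X ∖ u)
    eu∧Xu≡eu : lookup e u ∧ X u ≡ lookup e u
    eu∧Xu≡eu = trans (cong (lookup e u ∧_) Xu≡true) (∧-identityʳ (lookup e u))

module _ {r : ℕ} (G : MultiHypergraph n r) where

  degree : (Fin n → Bool) → ℕ
  degree X = ∑ (edges G) (λ e → 𝟙 (meets e X))

  deg≡degree : (X : Subset n) → deg G X ≡ degree (lookup X)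
  deg≡degree X = trans (length-filter≡∑ (λ e → nonempty? (e ∩ X)) (edges G))
                       (∑-cong (edges G) (λ e → cong 𝟙 (does≡ (nonempty? (e ∩ X)) (to e) (from e))))
    where
    to : ∀ e → Nonempty (e ∩ X) → T (meets e (lookup X))
    to e (v , v∈e∩X) with x∈p∩q⁻ e X v∈e∩X
    ... | v∈e , v∈X = meets⁺ e v (∈⇒T v∈e) (∈⇒T v∈X)
    from : ∀ e → T (meets e (lookup X)) → Nonempty (e ∩ X)
    from e m with meets⁻ e m
    ... | v , ev , Xv = v , x∈p∩q⁺ (T⇒∈ ev , T⇒∈ Xv)

  degree-cong : {X Y : Fin n → Bool} → (∀ v → X v ≡ Y v) → degree X ≡ degree Y
  degree-cong X≗Y = ∑-cong (edges G) (λ e → cong 𝟙 (meets-cong e X≗Y))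

  degree-mono : {X Y : Fin n → Bool} → (∀ v → T (X v) → T (Y v)) → degree X ≤ degree Y
  degree-mono X⊆Y = ∑-mono (edges G) (λ e → 𝟙-mono (meets-mono e X⊆Y))

-- Moving one vertex to another part

module _ {R : ℕ} where

  block : Partition n R → Fin R → Fin n → Bool
  block P j v = ⌊ P v ≟ j ⌋

  lookup-part : (P : Partition n R) (j : Fin R) (v : Fin n) → lookup (part P j) v ≡ block P j v
  lookup-part P j v = Vec.lookup∘tabulate _ v

  move : Partition n R → Fin n → Fin R → Partition n R
  move P u j = updateAt P u (const j)

  block-move-at : (P : Partition n R) (u : Fin n) (j i : Fin R) → block (move P u j) i u ≡ ⌊ j ≟ i ⌋
  block-move-at P u j i = cong (λ x → ⌊ x ≟ i ⌋) (updateAt-updates u P)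

  block-move-∖ : (P : Partition n R) (u : Fin n) (j i : Fin R) →
                 ∀ v → (block (move P u j) i ∖ u) v ≡ (block P i ∖ u) v
  block-move-∖ P u j i v with v ≟ u
  ... | yes refl = trans (∧-zeroʳ _) (sym (∧-zeroʳ _))
  ... | no  v≢u  = cong (λ x → ⌊ x ≟ i ⌋ ∧ true) (updateAt-minimal v u P v≢u)

  block-move-≢ : (P : Partition n R) (u : Fin n) {j i : Fin R} → j ≢ i →
                 ∀ v → block (move P u j) i v ≡ (block P i ∖ u) v
  block-move-≢ P u {j} {i} j≢i v =
    trans (sym (∖-absent (block (move P u j) i) (trans (block-move-at P u j i) (⌊⌋-false (j ≟ i) j≢i)) v))
          (block-move-∖ P u j i v)

  partsMet : Partition n R → Subset n → ℕ
  partsMet P e = ∑ (allFin R) (λ j → 𝟙 (meets e (block P j)))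

  totalDeg≡∑partsMet : {r : ℕ} (G : MultiHypergraph n r) (P : Partition n R) →
                       totalDeg G P ≡ ∑ (edges G) (partsMet P)
  totalDeg≡∑partsMet G P =
    trans (∑-cong (allFin R) (λ j → trans (deg≡degree G (part P j)) (degree-cong G (lookup-part P j))))
          (∑-comm (allFin R) (edges G) (λ j e → 𝟙 (meets e (block P j))))

  loses : Partition n R → Subset n → Fin n → Bool
  loses P e u = lookup e u ∧ not (meets e (block P (P u) ∖ u))

  gains : Partition n R → Fin R → Subset n → Fin n → Bool
  gains P j e u = lookup e u ∧ not (meets e (block P j))

  partsMet-move : (P : Partition n R) (u : Fin n) (j : Fin R) (e : Subset n) → P u ≢ j →
                  partsMet (move P u j) e + 𝟙 (loses P e u) ≡ partsMet P e + 𝟙 (gains P j e u)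
  partsMet-move P u j e Pu≢j = ∑-allFin-exchange _ _ _ _ Pu≢j unchanged source target
    where
    open ≡-Reasoning
    Q = move P u j
    unchanged : ∀ i → i ≢ P u → i ≢ j → 𝟙 (meets e (block Q i)) ≡ 𝟙 (meets e (block P i))
    unchanged i i≢Pu i≢j = cong 𝟙 (meets-cong e λ v →
      trans (block-move-≢ P u (i≢j ∘ sym) v)
            (∖-absent (block P i) (⌊⌋-false (P u ≟ i) (i≢Pu ∘ sym)) v))
    source : 𝟙 (meets e (block Q (P u))) + 𝟙 (loses P e u) ≡ 𝟙 (meets e (block P (P u)))
    source = begin
      𝟙 (meets e (block Q (P u))) + 𝟙 (loses P e u)
        ≡⟨ cong (λ b → 𝟙 b + 𝟙 (loses P e u)) (meets-cong e (block-move-≢ P u (Pu≢j ∘ sym))) ⟩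
      𝟙 (meets e (block P (P u) ∖ u)) + 𝟙 (loses P e u)
        ≡⟨ 𝟙-meets-∖ e (block P (P u)) (⌊⌋-true (P u ≟ P u) refl) ⟨
      𝟙 (meets e (block P (P u)))                            ∎
    target : 𝟙 (meets e (block Q j)) ≡ 𝟙 (meets e (block P j)) + 𝟙 (gains P j e u)
    target = begin
      𝟙 (meets e (block Q j))
        ≡⟨ 𝟙-meets-∖ e (block Q j) (trans (block-move-at P u j j) (⌊⌋-true (j ≟ j) refl)) ⟩
      𝟙 (meets e (block Q j ∖ u)) + 𝟙 (lookup e u ∧ not (meets e (block Q j ∖ u)))
        ≡⟨ cong (λ b → 𝟙 b + 𝟙 (lookup e u ∧ not b)) (meets-cong e Q∖u≗P) ⟩
      𝟙 (meets e (block P j)) + 𝟙 (gains P j e u) ∎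
      where
      Q∖u≗P : ∀ v → (block Q j ∖ u) v ≡ block P j v
      Q∖u≗P v = trans (block-move-∖ P u j j v) (∖-absent (block P j) (⌊⌋-false (P u ≟ j) Pu≢j) v)

  module _ {r : ℕ} (G : MultiHypergraph n r) (V : Partition n R)
           (optimal : ∀ (P : Partition n R) → totalDeg G P ≤ totalDeg G V) where

    gains≤loses : (u : Fin n) (j : Fin R) → V u ≢ j →
                  ∑ (edges G) (λ e → 𝟙 (gains V j e u)) ≤ ∑ (edges G) (λ e → 𝟙 (loses V e u))
    gains≤loses u j Vu≢j = +-cancelˡ-≤ (∑ E (partsMet V)) _ _ (begin
      ∑ E (partsMet V) + ∑ E (λ e → 𝟙 (gains V j e u))  ≡⟨ ∑-+ E (partsMet V) _ ⟨
      ∑ E (λ e → partsMet V e + 𝟙 (gains V j e u))      ≡⟨ ∑-cong E (λ e → partsMet-move V u j e Vu≢j) ⟨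
      ∑ E (λ e → partsMet Q e + 𝟙 (loses V e u))        ≡⟨ ∑-+ E (partsMet Q) _ ⟩
      ∑ E (partsMet Q) + ∑ E (λ e → 𝟙 (loses V e u))    ≤⟨ +-monoˡ-≤ _ Q≤V ⟩
      ∑ E (partsMet V) + ∑ E (λ e → 𝟙 (loses V e u))    ∎)
      where
      open ≤-Reasoning
      E = edges G
      Q = move V u j
      Q≤V : ∑ E (partsMet Q) ≤ ∑ E (partsMet V)
      Q≤V = subst₂ _≤_ (totalDeg≡∑partsMet G Q) (totalDeg≡∑partsMet G V) (optimal Q)

-- Counting against an optimal partition

ℓ : {p : ℕ} → Fin (suc p)
ℓ {p} = fromℕ p

_⊑_ : {p : ℕ} → Partition n (suc p) → Partition n (suc p) → Set
W ⊑ V = ∀ v → W v ≡ V v ⊎ W v ≡ ℓ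

⊑-refl : {p : ℕ} (W : Partition n (suc p)) → W ⊑ W
⊑-refl W v = inj₁ refl

⊑-trans : {p : ℕ} {W₁ W₂ W₃ : Partition n (suc p)} → W₁ ⊑ W₂ → W₂ ⊑ W₃ → W₁ ⊑ W₃
⊑-trans W₁⊑W₂ W₂⊑W₃ v with W₁⊑W₂ v
... | inj₂ W₁v≡ℓ  = inj₂ W₁v≡ℓ
... | inj₁ W₁v≡W₂v with W₂⊑W₃ v
...   | inj₁ W₂v≡W₃v = inj₁ (trans W₁v≡W₂v W₂v≡W₃v)
...   | inj₂ W₂v≡ℓ   = inj₂ (trans W₁v≡W₂v W₂v≡ℓ)

⊑-inner : {p : ℕ} {W W′ : Partition n (suc p)} → W ⊑ W′ →
          ∀ v i → W v ≡ inject₁ i → W′ v ≡ inject₁ i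
⊑-inner W⊑W′ v i Wv≡i with W⊑W′ v
... | inj₁ Wv≡W′v = trans (sym Wv≡W′v) Wv≡i
... | inj₂ Wv≡ℓ   = ⊥-elim (Fin.fromℕ≢inject₁ (trans (sym Wv≡ℓ) Wv≡i))

⊑⇒part⊆ : {p : ℕ} {W V : Partition n (suc p)} → W ⊑ V →
          ∀ i → part W (inject₁ i) ⊆ part V (inject₁ i)
⊑⇒part⊆ {W = W} {V} W⊑V i {v} v∈W = T⇒∈ (subst T (sym (lookup-part V (inject₁ i) v))
  (fromWitness (⊑-inner W⊑V v i (toWitness (subst T (lookup-part W (inject₁ i) v) (∈⇒T v∈W))))))

module Counting {p : ℕ} (G : MultiHypergraph n (suc p)) (V W : Partition n (suc p))
                (optimal : ∀ (P : Partition n (suc p)) → totalDeg G P ≤ totalDeg G V) (W⊑V : W ⊑ V) where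

  E : List (Subset n)
  E = edges G

  inner : Fin n → Bool
  inner u = not ⌊ W u ≟ ℓ ⌋

  inner⇒W≢ℓ : ∀ {u} → T (inner u) → W u ≢ ℓ
  inner⇒W≢ℓ {u} t Wu≡ℓ = T-not⁻ t (fromWitness Wu≡ℓ)

  inner⇒W≡V : ∀ {u} → T (inner u) → W u ≡ V u
  inner⇒W≡V {u} t with W⊑V u
  ... | inj₁ Wu≡Vu = Wu≡Vu
  ... | inj₂ Wu≡ℓ  = ⊥-elim (inner⇒W≢ℓ t Wu≡ℓ)

  gain≤loss-at : ∀ u → ∑ E (λ e → 𝟙 (inner u ∧ gains V ℓ e u)) ≤
                       ∑ E (λ e → 𝟙 (inner u ∧ loses V e u))
  gain≤loss-at u with inner u in eq
  ... | false = ≤-refl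
  ... | true  = gains≤loses G V optimal u ℓ Vu≢ℓ
    where
    inner-u : T (inner u)
    inner-u = subst T (sym eq) _
    Vu≢ℓ : V u ≢ ℓ
    Vu≢ℓ = inner⇒W≢ℓ inner-u ∘ trans (inner⇒W≡V inner-u)

  alone : Subset n → Fin n → Bool
  alone e u = lookup e u ∧ not (meets e (block W (W u) ∖ u))

  loses⇒alone : ∀ e u → T (inner u ∧ loses V e u) → T (inner u ∧ alone e u)
  loses⇒alone e u t with T-∧⁻ {inner u} t
  ... | inner-u , lost with T-∧⁻ {lookup e u} lost
  ...   | eu , ¬meetsV = T-∧⁺ inner-u (T-∧⁺ eu (T-not⁺ (T-not⁻ ¬meetsV ∘ meets-mono e W⊆V)))
    where
    W⊆V : ∀ v → T ((block W (W u) ∖ u) v) → T ((block V (V u) ∖ u) v)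
    W⊆V v t with T-∧⁻ {⌊ W v ≟ W u ⌋} t
    ... | Wv≡Wu , v≢u = T-∧⁺ (fromWitness (Vv≡Vu (toWitness Wv≡Wu))) v≢u
      where
      Vv≡Vu : W v ≡ W u → V v ≡ V u
      Vv≡Vu Wv≡Wu with W⊑V v
      ... | inj₁ Wv≡Vv = trans (sym Wv≡Vv) (trans Wv≡Wu (inner⇒W≡V inner-u))
      ... | inj₂ Wv≡ℓ  = ⊥-elim (inner⇒W≢ℓ inner-u (trans (sym Wv≡Wu) Wv≡ℓ))

  ∑-inner : (f : Fin n → Bool) → ∑ (allFin n) (λ u → 𝟙 (inner u ∧ f u)) ≡
            ∑ (allFin p) (λ i → ∑ (allFin n) (λ u → 𝟙 (block W (inject₁ i) u ∧ f u)))
  ∑-inner f = trans (∑-cong (allFin n) (λ u → sym (∑-allFin-inject₁-∧ (W u) (f u))))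
                    (∑-comm (allFin n) (allFin p) (λ u i → 𝟙 (block W (inject₁ i) u ∧ f u)))

  alone-unique : ∀ e {u v} → T (alone e u) → T (lookup e v) → W v ≡ W u → v ≡ u
  alone-unique e {u} {v} alone-u ev Wv≡Wu with v ≟ u
  ... | yes v≡u = v≡u
  ... | no  v≢u = ⊥-elim (T-not⁻ (proj₂ (T-∧⁻ {lookup e u} alone-u)) (meets⁺ e {block W (W u) ∖ u} v ev v∈))
    where
    v∈ : T ((block W (W u) ∖ u) v)
    v∈ = T-∧⁺ {⌊ W v ≟ W u ⌋} (fromWitness Wv≡Wu) (T-not⁺ (v≢u ∘ toWitness))

  meetsBlock aloneIn : Subset n → Fin p → ℕ
  meetsBlock e i = 𝟙 (meets e (block W (inject₁ i)))
  aloneIn e i = ∑ (allFin n) (λ u → 𝟙 (block W (inject₁ i) u ∧ alone e u))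

  aloneIn≤meetsBlock : ∀ e i → aloneIn e i ≤ meetsBlock e i
  aloneIn≤meetsBlock e i =
    ∑-𝟙-≤-𝟙 _ meets-block (λ u v tu tv → sym (alone-unique e (alone-of tu) (e-of tv) (same tv tu)))
    where
    alone-of : ∀ {u} → T (block W (inject₁ i) u ∧ alone e u) → T (alone e u)
    alone-of {u} = proj₂ ∘ T-∧⁻ {block W (inject₁ i) u}
    e-of : ∀ {u} → T (block W (inject₁ i) u ∧ alone e u) → T (lookup e u)
    e-of {u} = proj₁ ∘ T-∧⁻ {lookup e u} ∘ alone-of
    in-block : ∀ {u} → T (block W (inject₁ i) u ∧ alone e u) → W u ≡ inject₁ i
    in-block {u} = toWitness ∘ proj₁ ∘ T-∧⁻ {block W (inject₁ i) u}
    same : ∀ {u v} → T (block W (inject₁ i) v ∧ alone e v) → T (block W (inject₁ i) u ∧ alone e u) →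
           W v ≡ W u
    same tv tu = trans (in-block tv) (sym (in-block tu))
    meets-block : ∀ u → T (block W (inject₁ i) u ∧ alone e u) → T (meets e (block W (inject₁ i)))
    meets-block u t = meets⁺ e u (e-of t) (proj₁ (T-∧⁻ {block W (inject₁ i) u} t))

  blocksMet : Subset n → ℕ
  blocksMet e = ∑ (allFin p) (meetsBlock e)

  loss gain : Subset n → ℕ
  loss e = ∑ (allFin n) (λ u → 𝟙 (inner u ∧ loses V e u))
  gain e = ∑ (allFin n) (λ u → 𝟙 (inner u ∧ gains V ℓ e u))

  loss≤∑aloneIn : ∀ e → loss e ≤ ∑ (allFin p) (aloneIn e)
  loss≤∑aloneIn e =
    ≤-trans (∑-mono (allFin n) (λ u → 𝟙-mono (loses⇒alone e u))) (≤-reflexive (∑-inner (alone e)))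

  avoidsLast : Subset n → Bool
  avoidsLast e = not (meets e (block W ℓ))

  loss≤blocksMet : ∀ e → loss e ≤ blocksMet e
  loss≤blocksMet e = ≤-trans (loss≤∑aloneIn e) (∑-mono (allFin p) (aloneIn≤meetsBlock e))

  module _ (e : Subset n) (avoids : T (avoidsLast e)) (size : ∣ e ∣ ≡ suc p) where

    private
      inner-of-edge : ∀ {u} → T (lookup e u) → T (inner u)
      inner-of-edge {u} eu = T-not⁺ (T-not⁻ avoids ∘ meets⁺ e {block W ℓ} u eu)

      inner∧lookup : ∀ u → inner u ∧ lookup e u ≡ lookup e u
      inner∧lookup u = T-ext (proj₂ ∘ T-∧⁻ {inner u}) (λ eu → T-∧⁺ (inner-of-edge eu) eu)

      ¬meets-Vℓ : ¬ T (meets e (block V ℓ))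
      ¬meets-Vℓ = T-not⁻ avoids ∘ meets-mono e Vℓ⊆Wℓ
        where
        Vℓ⊆Wℓ : ∀ v → T (block V ℓ v) → T (block W ℓ v)
        Vℓ⊆Wℓ v t with W⊑V v
        ... | inj₁ Wv≡Vv = fromWitness (trans Wv≡Vv (toWitness t))
        ... | inj₂ Wv≡ℓ  = fromWitness Wv≡ℓ

      inner∧gains : ∀ u → inner u ∧ gains V ℓ e u ≡ lookup e u
      inner∧gains u = T-ext (proj₁ ∘ T-∧⁻ {lookup e u} ∘ proj₂ ∘ T-∧⁻ {inner u})
                            (λ eu → T-∧⁺ (inner-of-edge eu) (T-∧⁺ eu (T-not⁺ ¬meets-Vℓ)))

      hits : Fin p → ℕ
      hits i = ∑ (allFin n) (λ u → 𝟙 (block W (inject₁ i) u ∧ lookup e u))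

      ∑hits≡size : ∑ (allFin p) hits ≡ suc p
      ∑hits≡size = trans (sym (∑-inner (lookup e)))
        (trans (∑-cong (allFin n) (λ u → cong 𝟙 (inner∧lookup u))) (trans (∑-lookup≡∣∣ e) size))

      hits≤1 : ∀ i → meetsBlock e i ≤ aloneIn e i → hits i ≤ 1
      hits≤1 i m≤a = ∑-𝟙-≤1 _ unique
        where
        unique : ∀ u v → T (block W (inject₁ i) u ∧ lookup e u) →
                 T (block W (inject₁ i) v ∧ lookup e v) → u ≡ v
        unique u v tu tv with T-∧⁻ {block W (inject₁ i) u} tu | T-∧⁻ {block W (inject₁ i) v} tv
        ... | Wu≡i , eu | Wv≡i , ev
          with ∑-𝟙-exists _ (≤-trans (𝟙-pos (meets⁺ e {block W (inject₁ i)} u eu Wu≡i)) m≤a)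
        ...   | w , tw with T-∧⁻ {block W (inject₁ i) w} tw
        ...     | Ww≡i , alone-w =
          trans (alone-unique e alone-w eu (same Wu≡i)) (sym (alone-unique e alone-w ev (same Wv≡i)))
          where
          same : ∀ {x} → T (block W (inject₁ i) x) → W x ≡ W w
          same {x} Wx≡i =
            trans (toWitness {a? = W x ≟ inject₁ i} Wx≡i) (sym (toWitness {a? = W w ≟ inject₁ i} Ww≡i))

    gain≡size : gain e ≡ suc p
    gain≡size =
      trans (∑-cong (allFin n) (λ u → cong 𝟙 (inner∧gains u))) (trans (∑-lookup≡∣∣ e) size)

    loss<blocksMet : loss e < blocksMet e
    loss<blocksMet with ∑-<-or-≥ (aloneIn e) (meetsBlock e) (aloneIn≤meetsBlock e)
    ... | inj₁ ∑a<∑m = ≤-<-trans (loss≤∑aloneIn e) ∑a<∑m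
    -- otherwise e has at most one vertex in each of the p inner blocks, but it has suc p vertices
    ... | inj₂ m≤a   = ⊥-elim (1+n≰n (begin
      suc p                       ≡⟨ ∑hits≡size ⟨
      ∑ (allFin p) hits           ≤⟨ ∑-mono (allFin p) (λ i → hits≤1 i (m≤a i)) ⟩
      ∑ (allFin p) (λ _ → 1)      ≡⟨ ∑-const-1 (allFin p) ⟩
      length (allFin p)           ≡⟨ List.length-tabulate id ⟩
      p                           ∎))
      where open ≤-Reasoning

  gain-avoiding : ∀ e → ∣ e ∣ ≡ suc p → suc p ℕ.* 𝟙 (avoidsLast e) ≤ gain e
  gain-avoiding e size with avoidsLast e in eq
  ... | false = subst (_≤ gain e) (sym (*-zeroʳ (suc p))) z≤n
  ... | true  = ≤-reflexive (trans (*-identityʳ (suc p)) (sym (gain≡size e (subst T (sym eq) _) size)))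

  loss-avoiding : ∀ e → ∣ e ∣ ≡ suc p → 𝟙 (avoidsLast e) + loss e ≤ blocksMet e
  loss-avoiding e size with avoidsLast e in eq
  ... | false = loss≤blocksMet e
  ... | true  = loss<blocksMet e (subst T (sym eq) _) size

  ∑gain≤∑loss : ∑ E gain ≤ ∑ E loss
  ∑gain≤∑loss = begin
    ∑ E gain                                                        ≡⟨ ∑-comm E (allFin n) _ ⟩
    ∑ (allFin n) (λ u → ∑ E (λ e → 𝟙 (inner u ∧ gains V ℓ e u)))
      ≤⟨ ∑-mono (allFin n) gain≤loss-at ⟩
    ∑ (allFin n) (λ u → ∑ E (λ e → 𝟙 (inner u ∧ loses V e u)))    ≡⟨ ∑-comm E (allFin n) _ ⟨
    ∑ E loss                                                        ∎
    where open ≤-Reasoning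

  counting : All (λ e → ∣ e ∣ ≡ suc p) E →
             suc (suc p) ℕ.* ∑ E (𝟙 ∘ avoidsLast) ≤ ∑ E blocksMet
  counting uniform = begin
    suc (suc p) ℕ.* N                           ≡⟨ cong (N +_) (∑-*ˡ E (suc p) _) ⟨
    N + ∑ E (λ e → suc p ℕ.* 𝟙 (avoidsLast e))  ≤⟨ +-monoʳ-≤ N (∑-mono-All uniform (λ {e} → gain-avoiding e)) ⟩
    N + ∑ E gain                                ≤⟨ +-monoʳ-≤ N ∑gain≤∑loss ⟩
    N + ∑ E loss                                ≡⟨ ∑-+ E _ loss ⟨
    ∑ E (λ e → 𝟙 (avoidsLast e) + loss e)       ≤⟨ ∑-mono-All uniform (λ {e} → loss-avoiding e) ⟩
    ∑ E blocksMet                               ∎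
    where
    open ≤-Reasoning
    N = ∑ E (𝟙 ∘ avoidsLast)

-- The greedy refinement

module Greedy {p r : ℕ} (G : MultiHypergraph n r) (Heavy : ℕ → Set) (heavy? : ∀ x → Dec (Heavy x))
              (heavy-mono : ∀ {x y} → x ≤ y → Heavy x → Heavy y) where

  AllHeavy : Partition n (suc p) → Set
  AllHeavy W = ∀ i → Heavy (degree G (block W (inject₁ i)))

  Minimal : Partition n (suc p) → Fin n → Set
  Minimal W u = ∀ i → W u ≡ inject₁ i → ¬ Heavy (degree G (block W (inject₁ i) ∖ u))

  Minimal-⊑ : {W W′ : Partition n (suc p)} → W ⊑ W′ → ∀ u → Minimal W′ u → Minimal W u
  Minimal-⊑ {W} {W′} W⊑W′ u minimal i Wu≡i heavy =
    minimal i (⊑-inner W⊑W′ u i Wu≡i) (heavy-mono (degree-mono G shrink) heavy)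
    where
    shrink : ∀ v → T ((block W (inject₁ i) ∖ u) v) → T ((block W′ (inject₁ i) ∖ u) v)
    shrink v t with T-∧⁻ {block W (inject₁ i) v} t
    ... | Wv≡i , v≢u = T-∧⁺ (fromWitness (⊑-inner W⊑W′ v i (toWitness Wv≡i))) v≢u

  move-⊑ : (W : Partition n (suc p)) (u : Fin n) → move W u ℓ ⊑ W
  move-⊑ W u v with v ≟ u
  ... | yes refl = inj₂ (updateAt-updates u W)
  ... | no  v≢u  = inj₁ (updateAt-minimal v u W v≢u)

  move-AllHeavy : (W : Partition n (suc p)) (u : Fin n) → AllHeavy W →
                  Heavy (degree G (block W (W u) ∖ u)) → AllHeavy (move W u ℓ)
  move-AllHeavy W u heavy heavy-u i =
    subst Heavy (sym (degree-cong G (block-move-≢ W u Fin.fromℕ≢inject₁))) (heavy-∖ (W u ≟ inject₁ i))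
    where
    heavy-∖ : Dec (W u ≡ inject₁ i) → Heavy (degree G (block W (inject₁ i) ∖ u))
    heavy-∖ (yes Wu≡i) = subst (λ j → Heavy (degree G (block W j ∖ u))) Wu≡i heavy-u
    heavy-∖ (no  Wu≢i) = subst Heavy (sym (degree-cong G (∖-absent (block W (inject₁ i)) u∉))) (heavy i)
      where
      u∉ : block W (inject₁ i) u ≡ false
      u∉ = ⌊⌋-false (W u ≟ inject₁ i) Wu≢i

  last-minimal : ∀ W {u} → W u ≡ ℓ → Minimal W u
  last-minimal W Wu≡ℓ i Wu≡i _ = Fin.fromℕ≢inject₁ (trans (sym Wu≡ℓ) Wu≡i)

  Step : Partition n (suc p) → Fin n → Set
  Step W u = Σ (Partition n (suc p)) λ W′ → AllHeavy W′ × W′ ⊑ W × Minimal W′ u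

  step : (W : Partition n (suc p)) → AllHeavy W → (u : Fin n) → Step W u
  step W heavy u with W u ≟ ℓ | heavy? (degree G (block W (W u) ∖ u))
  ... | yes Wu≡ℓ | _           = W , heavy , ⊑-refl W , last-minimal W Wu≡ℓ
  ... | no  _    | no  light   =
    W , heavy , ⊑-refl W , λ i Wu≡i → subst (λ j → ¬ Heavy (degree G (block W j ∖ u))) Wu≡i light
  ... | no  _    | yes heavy-u =
    move W u ℓ , move-AllHeavy W u heavy heavy-u , move-⊑ W u , last-minimal (move W u ℓ) (updateAt-updates u W)

  Run : Partition n (suc p) → List (Fin n) → Set
  Run W us = Σ (Partition n (suc p)) λ W′ → AllHeavy W′ × W′ ⊑ W × All (Minimal W′) us

  run : (W : Partition n (suc p)) → AllHeavy W → (us : List (Fin n)) → Run W us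
  run W heavy []       = W , heavy , ⊑-refl W , []
  run W heavy (u ∷ us) with step W heavy u
  ... | W₁ , heavy₁ , W₁⊑W , minimal-u with run W₁ heavy₁ us
  ...   | W₂ , heavy₂ , W₂⊑W₁ , minimal-us =
    W₂ , heavy₂ , ⊑-trans W₂⊑W₁ W₁⊑W , Minimal-⊑ W₂⊑W₁ u minimal-u ∷ minimal-us

  greedy : (V : Partition n (suc p)) → AllHeavy V →
           Σ (Partition n (suc p)) λ W → AllHeavy W × W ⊑ V × (∀ u → Minimal W u)
  greedy V heavy with run V heavy (allFin n)
  ... | W , heavy-W , W⊑V , minimal = W , heavy-W , W⊑V , All.tabulate⁻ minimal

toℚ≡mkℚ : ∀ x → toℚ x ≡ mkℚ (ℤ.+ x) 0 (Coprime.sym (1-coprimeTo x))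
toℚ≡mkℚ x = ℚ.normalize-coprime (Coprime.sym (1-coprimeTo x))

toℚ-+ : ∀ x y → toℚ (x + y) ≡ toℚ x ℚ.+ toℚ y
toℚ-+ x y rewrite toℚ≡mkℚ x | toℚ≡mkℚ y = cong (_/ 1) (sym (begin
  ℤ.+ x ℤ.* ℤ.+ 1 ℤ.+ ℤ.+ y ℤ.* ℤ.+ 1  ≡⟨ cong₂ ℤ._+_ (ℤ.*-identityʳ (ℤ.+ x)) (ℤ.*-identityʳ (ℤ.+ y)) ⟩
  ℤ.+ x ℤ.+ ℤ.+ y                      ≡⟨ ℤ.pos-+ x y ⟨
  ℤ.+ (x + y)                          ∎))
  where open ≡-Reasoning

toℚ-* : ∀ x y → toℚ (x ℕ.* y) ≡ toℚ x ℚ.* toℚ y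
toℚ-* x y rewrite toℚ≡mkℚ x | toℚ≡mkℚ y = cong (_/ 1) (ℤ.pos-* x y)

toℚ-mono : ∀ {x y} → x ≤ y → toℚ x ℚ.≤ toℚ y
toℚ-mono {x} {y} x≤y rewrite toℚ≡mkℚ x | toℚ≡mkℚ y =
  ℚ.*≤* (subst₂ ℤ._≤_ (sym (ℤ.*-identityʳ (ℤ.+ x))) (sym (ℤ.*-identityʳ (ℤ.+ y))) (ℤ.+≤+ x≤y))

toℚ-positive : ∀ x → ℚ.Positive (toℚ (suc x))
toℚ-positive x rewrite toℚ≡mkℚ (suc x) = _

x≡w+z∧w<y⇒x-y<z : ∀ (x w z y : ℚ) → x ≡ w ℚ.+ z → w ℚ.< y → x ℚ.- y ℚ.< z
x≡w+z∧w<y⇒x-y<z x w z y x≡w+z w<y = subst (λ q → q ℚ.- y ℚ.< z) (sym x≡w+z) (ℚ.<-≤-trans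
  (ℚ.+-monoˡ-< (ℚ.- y) (ℚ.+-monoˡ-< z w<y))
  (ℚ.≤-reflexive (begin
    (y ℚ.+ z) ℚ.- y   ≡⟨ cong (ℚ._- y) (ℚ.+-comm y z) ⟩
    (z ℚ.+ y) ℚ.- y   ≡⟨ ℚ.+-assoc z y (ℚ.- y) ⟩
    z ℚ.+ (y ℚ.- y)   ≡⟨ cong (z ℚ.+_) (ℚ.+-inverseʳ y) ⟩
    z ℚ.+ 0ℚ          ≡⟨ ℚ.+-identityʳ z ⟩
    z                 ∎)))
  where open ≡-Reasoning

module _ {r : ℕ} (G : MultiHypergraph n r) where

  deg-part : {R : ℕ} (P : Partition n R) (j : Fin R) → deg G (part P j) ≡ degree G (block P j)
  deg-part P j = trans (deg≡degree G (part P j)) (degree-cong G (lookup-part P j))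

  deg-part-- : {R : ℕ} (P : Partition n R) (j : Fin R) (w : Fin n) →
               deg G (part P j - w) ≡ degree G (block P j ∖ w)
  deg-part-- P j w = trans (deg≡degree G (part P j - w))
    (degree-cong G (λ v → trans (lookup-- (part P j) w v) (cong (_∧ not ⌊ v ≟ w ⌋) (lookup-part P j v))))

  #edges≡degree+avoiding : (X : Fin n → Bool) →
                           #edges G ≡ degree G X + ∑ (edges G) (λ e → 𝟙 (not (meets e X)))
  #edges≡degree+avoiding X = begin
    #edges G                                                 ≡⟨ ∑-const-1 (edges G) ⟨
    ∑ (edges G) (λ _ → 1)                                    ≡⟨ ∑-cong (edges G) (𝟙+𝟙-not ∘ flip meets X) ⟨
    ∑ (edges G) (λ e → 𝟙 (meets e X) + 𝟙 (not (meets e X)))  ≡⟨ ∑-+ (edges G) _ _ ⟩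
    degree G X + ∑ (edges G) (λ e → 𝟙 (not (meets e X)))     ∎
    where open ≡-Reasoning

module Threshold {k : ℕ} (G : MultiHypergraph n (suc (suc k))) (c : ℚ) where

  Heavy : ℕ → Set
  Heavy x = c * toℚ (#edges G) ℚ.≤ toℚ x

  heavy? : ∀ x → Dec (Heavy x)
  heavy? x = c * toℚ (#edges G) ℚ.≤? toℚ x

  heavy-mono : ∀ {x y} → x ≤ y → Heavy x → Heavy y
  heavy-mono x≤y h = ℚ.≤-trans h (toℚ-mono x≤y)

  open Greedy {p = suc k} G Heavy heavy? heavy-mono public

  AllHeavy-sorted : (V : Partition n (suc (suc k))) →
                    (∀ i j → i Data.Fin.≤ j → deg G (part V j) ≤ deg G (part V i)) →
                    Heavy (deg G (part V (inject₁ (fromℕ k)))) → AllHeavy V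
  AllHeavy-sorted V sorted heavy i =
    subst Heavy (deg-part G V (inject₁ i)) (heavy-mono (sorted (inject₁ i) (inject₁ (fromℕ k)) i≤k) heavy)
    where
    i≤k : inject₁ i Data.Fin.≤ inject₁ (fromℕ k)
    i≤k = subst₂ _≤_ (sym (Fin.toℕ-inject₁ i)) (sym (Fin.toℕ-inject₁ (fromℕ k))) (Fin.≤fromℕ i)

  inner-parts-heavy : (W : Partition n (suc (suc k))) → AllHeavy W →
                      ∀ i → Heavy (deg G (part W (inject₁ i)))
  inner-parts-heavy W heavy i = subst Heavy (sym (deg-part G W (inject₁ i))) (heavy i)

  all-parts-heavy : (W : Partition n (suc (suc k))) → AllHeavy W → Heavy (degree G (block W ℓ)) →
                    ∀ j → Heavy (deg G (part W j))
  all-parts-heavy W heavy heavy-ℓ j with view j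
  ... | ‵fromℕ  = subst Heavy (sym (deg-part G W ℓ)) heavy-ℓ
  ... | ‵inj₁ {i = i} _ = inner-parts-heavy W heavy i

  minimal-parts : (W : Partition n (suc (suc k))) → (∀ u → Minimal W u) →
                  ∀ i w → w ∈ part W (inject₁ i) →
                  toℚ (deg G (part W (inject₁ i) - w)) ℚ.< c * toℚ (#edges G)
  minimal-parts W minimal i w w∈W = ℚ.≰⇒> λ heavy →
    minimal w i (toWitness (subst T (lookup-part W (inject₁ i) w) (∈⇒T w∈W)))
                (subst Heavy (deg-part-- G W (inject₁ i) w) heavy)

  deficit-bound : (V W : Partition n (suc (suc k))) →
                  (∀ (P : Partition n (suc (suc k))) → totalDeg G P ≤ totalDeg G V) → W ⊑ V →
                  ¬ Heavy (degree G (block W ℓ)) →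
                  toℚ (suc (suc k) + 1) * (toℚ (#edges G) ℚ.- c * toℚ (#edges G)) ℚ.<
                  toℚ (sum (map (λ i → deg G (part W (inject₁ i))) (allFin (suc k))))
  deficit-bound V W optimal W⊑V light = ℚ.<-≤-trans scaled-deficit (toℚ-mono scaled-count)
    where
    open Counting G V W optimal W⊑V
    m N S : ℕ
    m = #edges G
    N = ∑ E (𝟙 ∘ avoidsLast)
    S = sum (map (λ i → deg G (part W (inject₁ i))) (allFin (suc k)))
    ∑blocksMet≡S : ∑ E blocksMet ≡ S
    ∑blocksMet≡S = trans (∑-comm E (allFin (suc k)) meetsBlock)
                         (∑-cong (allFin (suc k)) (λ i → sym (deg-part G W (inject₁ i))))
    scaled-count : (suc (suc k) + 1) ℕ.* N ≤ S
    scaled-count =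
      subst₂ (λ x y → x ℕ.* N ≤ y) (+-comm 1 (suc (suc k))) ∑blocksMet≡S (counting (uniform G))
    deficit : toℚ m ℚ.- c * toℚ m ℚ.< toℚ N
    deficit = x≡w+z∧w<y⇒x-y<z (toℚ m) (toℚ (degree G (block W ℓ))) (toℚ N) (c * toℚ m)
                (trans (cong toℚ (#edges≡degree+avoiding G (block W ℓ))) (toℚ-+ (degree G (block W ℓ)) N))
                (ℚ.≰⇒> light)
    scaled-deficit : toℚ (suc (suc k) + 1) * (toℚ m ℚ.- c * toℚ m) ℚ.< toℚ ((suc (suc k) + 1) ℕ.* N)
    scaled-deficit = subst (toℚ (suc (suc k) + 1) * (toℚ m ℚ.- c * toℚ m) ℚ.<_)
                           (sym (toℚ-* (suc (suc k) + 1) N))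
                           (ℚ.*-monoʳ-<-pos (toℚ (suc (suc k) + 1)) {{toℚ-positive (suc k + 1)}} deficit)

open Threshold

lemma4 : (n k : ℕ) (G : MultiHypergraph n (suc (suc k))) (c : ℚ) → 0ℚ Data.Rational.< c →
    (V : Partition n (suc (suc k))) →
    (∀ (P : Partition n (suc (suc k))) → totalDeg G P Data.Nat.≤ totalDeg G V) →
    (∀ (i j : Fin (suc (suc k))) → i Data.Fin.≤ j → deg G (part V j) Data.Nat.≤ deg G (part V i)) →
    c * toℚ (#edges G) Data.Rational.≤ toℚ (deg G (part V (inject₁ (fromℕ k)))) →
    (Σ (Partition n (suc (suc k))) λ W →
        (∀ (i : Fin (suc k)) → part W (inject₁ i) ⊆ part V (inject₁ i))
      × (∀ (i : Fin (suc (suc k))) → c * toℚ (#edges G) Data.Rational.≤ toℚ (deg G (part W i))))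
    ⊎
    (Σ (Partition n (suc (suc k))) λ W →
        (∀ (i : Fin (suc k)) → part W (inject₁ i) ⊆ part V (inject₁ i))
      × (∀ (i : Fin (suc k)) → c * toℚ (#edges G) Data.Rational.≤ toℚ (deg G (part W (inject₁ i))))
      × (∀ (i : Fin (suc k)) (w : Fin n) → w ∈ part W (inject₁ i) →
           toℚ (deg G (part W (inject₁ i) - w)) Data.Rational.< c * toℚ (#edges G))
      × (toℚ (suc (suc k) + 1) * (toℚ (#edges G) Data.Rational.- c * toℚ (#edges G))
           Data.Rational.< toℚ (sum (map (λ i → deg G (part W (inject₁ i))) (allFin (suc k))))))
-- Pattern-matching lambdas are used instead of `with`,
-- whose abstraction would normalise the toℚ terms of the goal into gcd computations.
lemma4 n k G c _ V optimal sorted heavy-V =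
  case greedy G c V (AllHeavy-sorted G c V sorted heavy-V) of λ where
    (W , heavy-W , W⊑V , minimal) → case heavy? G c (degree G (block W ℓ)) of λ where
      (yes heavy-ℓ) → inj₁ (W , ⊑⇒part⊆ W⊑V , all-parts-heavy G c W heavy-W heavy-ℓ)
      (no  light-ℓ) → inj₂ (W , ⊑⇒part⊆ W⊑V , inner-parts-heavy G c W heavy-W ,
                             minimal-parts G c W minimal , deficit-bound G c V W optimal W⊑V light-ℓ)
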